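{- Let $g,\gamma\ge 0$ be integers and let ${\rm T}$ be a $(3,\gamma)$-hyperelliptic numerical semigroup of genus $g$. Let $u_1=u_1({\rm T})$ and $\chi := u_1-g+3\gamma-1-\lfloor\frac{(g)_3}{2}\rfloor$. Then \[ \#{\rm T}_{3-(u_1)_3} \leq \gamma+ \left\lceil \frac{\chi}{3} \right\rceil . \]
   Context: $\mathbb{N}=\{0,1,2,\dots\}$. A numerical semigroup is a subset ${\rm S}\subseteq\mathbb{N}$ containing $0$, closed under addition, with finite complement; its genus is $\#(\mathbb{N}\setminus{\rm S})$. For integers $N,\gamma\ge 0$, ${\rm S}$ is $(N,\gamma)$-hyperelliptic if (1) its first $\gamma$ positive elements $n_1<\dots<n_\gamma$ are multiples of $N$ and $n_\gamma=2\gamma N$, and (2) $(2\gamma+1)N\in{\rm S}$. $(x)_M$ denotes the residue of $x$ modulo $M$ in $\{0,\dots,M-1\}$; $[m]=\{1,\dots,m\}$. For a numerical semigroup ${\rm T}$ of genus $g$: ${\rm T}_i=\{t\in{\rm T}\cap[2g]: (t)_3=i\}$ for $i=0,1,2$, and $u_1({\rm T})=\min\{t\in{\rm T}: (t)_3\neq 0\}$. -}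

module Defs where

open import Data.Nat using (ℕ; zero; suc; _+_; _*_; _∸_; _≤_; _<_; _%_; _/_)
open import Data.Nat.Divisibility using (_∣_)
open import Data.Bool using (Bool; true; false; not; _∧_; if_then_else_)
open import Data.Product using (Σ; ∃; _×_)
open import Relation.Binary.PropositionalEquality using (_≡_)
open import Relation.Nullary using (¬_)
open import Data.Integer as ℤ using (ℤ; +_)

record NumericalSemigroup : Set where
  field
    mem      : ℕ → Bool
    zero∈    : mem 0 ≡ true
    closed   : ∀ a b → mem a ≡ true → mem b ≡ true → mem (a + b) ≡ true
    cofinite : ∃ λ c → ∀ n → c ≤ n → mem n ≡ true
open NumericalSemigroup public

_∈S_ : ℕ → NumericalSemigroup → Set
n ∈S S = mem S n ≡ true

-- #{ k ∈ [n] = {1,…,n} : p k }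
count : (ℕ → Bool) → ℕ → ℕ
count p zero    = 0
count p (suc n) = (if p (suc n) then 1 else 0) + count p n

gapsBelow : NumericalSemigroup → ℕ → ℕ
gapsBelow S zero    = 0
gapsBelow S (suc c) = (if mem S c then 0 else 1) + gapsBelow S c

-- S has genus g: #(ℕ ∖ S) = g  (all gaps lie below some c; count them)
HasGenus : NumericalSemigroup → ℕ → Set
HasGenus S g = ∃ λ c → (∀ n → c ≤ n → n ∈S S) × gapsBelow S c ≡ g

-- (N,γ)-hyperelliptic: the first γ positive elements are exactly the elements
-- of S ∩ [2γN] (there are γ of them, the largest being 2γN), all multiples of N,
-- and (2γ+1)N ∈ S.
Hyperelliptic : ℕ → ℕ → NumericalSemigroup → Set
Hyperelliptic N γ S =
  (count (mem S) (2 * γ * N) ≡ γ)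
  × (1 ≤ γ → (2 * γ * N) ∈S S)
  × (∀ n → 1 ≤ n → n ≤ 2 * γ * N → n ∈S S → N ∣ n)
  × (((2 * γ + 1) * N) ∈S S)

-- u is u₁(T) = min { t ∈ T : (t)₃ ≠ 0 }
IsU1 : NumericalSemigroup → ℕ → Set
IsU1 T u = (u ∈S T) × ¬ (u % 3 ≡ 0) × (∀ t → t < u → t ∈S T → t % 3 ≡ 0)

-- #T_i = #{ t ∈ T ∩ [2g] : (t)₃ = i }
cardT : NumericalSemigroup → ℕ → ℕ → ℕ
cardT T g i = count (λ t → mem T t ∧ (t % 3 Data.Nat.≡ᵇ i)) (2 * g)

-- ⌈ x / 3 ⌉ for an integer x  (_/ℕ_ is floor division for a positive divisor)
ceil3 : ℤ → ℤ
ceil3 x = ℤ.- ((ℤ.- x) ℤ./ℕ 3)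

chi : ℕ → ℕ → ℕ → ℤ
chi u g γ = + u ℤ.- + g ℤ.+ + (3 * γ) ℤ.- + 1 ℤ.- + ((g % 3) / 2)

module Submission where

-- Write r = (u₁)₃ ∈ {1,2} and i = 3 − r.  Every gap of T has residue 0, r or i,
-- and a gap of residue i is not an element of residue i; counting over [2g]
-- (which contains all g gaps) gives  #T_i + g ≤ A_i + G₀ + G_r, where A_i is the
-- size of the residue class i in [2g] and G_j the number of gaps of residue j.
-- Three facts bound the right-hand side:
--   * G₀ ≤ γ: T/3 = { j : 3j ∈ T } is closed under addition, T/3 ∩ [2γ] has γ
--     elements and 2γ+1 ∈ T/3, so T/3 contains everything above 2γ;
--   * G_r + 1 ≤ A_r(u₁) + G₀: a gap t+u₁ of residue r forces t to be a gap of
--     residue 0, and u₁ itself is an element of residue r;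
--   * the sizes of the residue classes i and r in [2g] and [u₁] are explicit.
-- Both "closed predicate" facts (all gaps lie below 2g, and the tail of T/3) come
-- from one reflection argument: if P is additively closed and y+1 ∉ P then
-- t ↦ y+1−t maps P ∩ [y] into the complement of P.  The file develops counting
-- on [n], closed predicates, the genus, residues mod 3, the hyperelliptic
-- structure and u₁ in turn, then combines the inequalities: first 3·#T_i + g ≤
-- u₁ + 6γ in ℕ, then the integer ceiling bound.

open import Defs
open import Data.Nat
open import Data.Nat.Properties
open import Data.Nat.DivMod
open import Data.Nat.Divisibility using (divides; n∣m⇒m%n≡0; m%n≡0⇒n∣m)
open import Data.Bool using (Bool; true; false; not; _∧_; if_then_else_)
open import Data.Bool.Properties using (T-≡; ∧-identityʳ; ∧-zeroʳ; ∧-conicalʳ)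
open import Function.Bundles using (Equivalence)
open import Data.Product using (_,_; _×_; proj₁; proj₂)
open import Relation.Nullary using (yes; no; contradiction)
open import Relation.Binary.PropositionalEquality
open import Data.Nat.Tactic.RingSolver using (solve-∀)
import Data.Integer as ℤ
import Data.Integer.Properties as ℤP
import Data.Integer.Tactic.RingSolver as ℤSolver
open import Data.Integer.DivMod using ([n/ℕd]*d≤n)

ind : Bool → ℕ
ind b = if b then 1 else 0

sumTo : (ℕ → ℕ) → ℕ → ℕ
sumTo f zero    = 0
sumTo f (suc n) = f (suc n) + sumTo f n

-- A count is the sum of the indicators; sums are easier to add and compare.
count≡sumTo : ∀ (p : ℕ → Bool) n → count p n ≡ sumTo (λ t → ind (p t)) n
count≡sumTo p zero    = refl
count≡sumTo p (suc n) = cong (ind (p (suc n)) +_) (count≡sumTo p n)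

sumTo-+ : ∀ (f g : ℕ → ℕ) n → sumTo (λ t → f t + g t) n ≡ sumTo f n + sumTo g n
sumTo-+ f g zero    = refl
sumTo-+ f g (suc n) = begin
  f (suc n) + g (suc n) + sumTo (λ t → f t + g t) n ≡⟨ cong (f (suc n) + g (suc n) +_) (sumTo-+ f g n) ⟩
  f (suc n) + g (suc n) + (sumTo f n + sumTo g n)   ≡⟨ +-+-swap (f (suc n)) (g (suc n)) (sumTo f n) (sumTo g n) ⟩
  f (suc n) + sumTo f n + (g (suc n) + sumTo g n)   ∎
  where
  open ≡-Reasoning
  +-+-swap : ∀ a b c d → a + b + (c + d) ≡ a + c + (b + d)
  +-+-swap = solve-∀

sumTo-mono : ∀ (f g : ℕ → ℕ) n → (∀ t → 1 ≤ t → t ≤ n → f t ≤ g t) → sumTo f n ≤ sumTo g n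
sumTo-mono f g zero    _ = z≤n
sumTo-mono f g (suc n) h =
  +-mono-≤ (h (suc n) (s≤s z≤n) ≤-refl) (sumTo-mono f g n (λ t 1≤t t≤n → h t 1≤t (m≤n⇒m≤1+n t≤n)))

count-mono : ∀ (p q : ℕ → Bool) n → (∀ t → 1 ≤ t → t ≤ n → p t ≡ true → q t ≡ true) →
  count p n ≤ count q n
count-mono p q n h = subst₂ _≤_ (sym (count≡sumTo p n)) (sym (count≡sumTo q n))
  (sumTo-mono _ _ n pointwise)
  where
  pointwise : ∀ t → 1 ≤ t → t ≤ n → ind (p t) ≤ ind (q t)
  pointwise t 1≤t t≤n with p t in pt
  ... | false = z≤n
  ... | true rewrite h t 1≤t t≤n pt = ≤-refl

count-cong : ∀ (p q : ℕ → Bool) n → (∀ t → 1 ≤ t → t ≤ n → p t ≡ q t) → count p n ≡ count q n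
count-cong p q zero    h = refl
count-cong p q (suc n) h = cong₂ _+_ (cong ind (h (suc n) (s≤s z≤n) ≤-refl))
  (count-cong p q n (λ t 1≤t t≤n → h t 1≤t (m≤n⇒m≤1+n t≤n)))

count-split : ∀ (p : ℕ → Bool) b a → count p (b + a) ≡ count (λ t → p (t + a)) b + count p a
count-split p zero    a = refl
count-split p (suc b) a = trans (cong (ind (p (suc (b + a))) +_) (count-split p b a))
  (sym (+-assoc (ind (p (suc (b + a)))) _ _))

count-monoN : ∀ (p : ℕ → Bool) {m n} → m ≤ n → count p m ≤ count p n
count-monoN p {m} {n} m≤n = begin
  count p m                                    ≤⟨ m≤n+m (count p m) _ ⟩
  count (λ t → p (t + m)) (n ∸ m) + count p m  ≡⟨ sym (count-split p (n ∸ m) m) ⟩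
  count p (n ∸ m + m)                          ≡⟨ cong (count p) (m∸n+n≡m m≤n) ⟩
  count p n                                    ∎
  where open ≤-Reasoning

count-compl : ∀ (p : ℕ → Bool) n → count p n + count (λ t → not (p t)) n ≡ n
count-compl p zero = refl
count-compl p (suc n) with p (suc n)
... | true  = cong suc (count-compl p n)
... | false = trans (+-suc (count p n) _) (cong suc (count-compl p n))

count-reflect : ∀ (p : ℕ → Bool) n → count p n ≡ count (λ t → p (suc n ∸ t)) n
count-reflect p zero    = refl
count-reflect p (suc n) = begin
  ind (p (suc n)) + count p n
    ≡⟨ cong (ind (p (suc n)) +_) (count-reflect p n) ⟩
  ind (p (suc n)) + count (λ t → p (suc n ∸ t)) n
    ≡⟨ +-comm (ind (p (suc n))) _ ⟩
  count (λ t → p (suc n ∸ t)) n + ind (p (suc n))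
    ≡⟨ sym (count-last-to-first (λ t → p (suc (suc n) ∸ t)) n) ⟩
  count (λ t → p (suc (suc n) ∸ t)) (suc n)
    ∎
  where
  open ≡-Reasoning
  count-last-to-first : ∀ (q : ℕ → Bool) m → count q (suc m) ≡ count (λ t → q (suc t)) m + ind (q 1)
  count-last-to-first q m = begin
    count q (suc m)                          ≡⟨ cong (count q) (+-comm 1 m) ⟩
    count q (m + 1)                          ≡⟨ count-split q m 1 ⟩
    count (λ t → q (t + 1)) m + count q 1    ≡⟨ cong₂ _+_ (count-cong _ _ m (λ t _ _ → cong q (+-comm t 1))) (+-identityʳ _) ⟩
    count (λ t → q (suc t)) m + ind (q 1)    ∎

count-beyond : ∀ (p : ℕ → Bool) a → (∀ t → a < t → p t ≡ false) → ∀ n → count p n ≤ count p a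
count-beyond p a h zero = z≤n
count-beyond p a h (suc n) with suc n ≤? a
... | yes n<a = count-monoN p n<a
... | no  n≮a rewrite h (suc n) (≰⇒> n≮a) = count-beyond p a h n

count-strict : ∀ (p q : ℕ → Bool) v → p (suc v) ≡ false → q (suc v) ≡ true →
  (∀ t → 1 ≤ t → t ≤ v → p t ≡ true → q t ≡ true) → count p (suc v) + 1 ≤ count q (suc v)
count-strict p q v p-last q-last h rewrite p-last | q-last =
  subst (_≤ suc (count q v)) (+-comm 1 (count p v)) (s≤s (count-mono p q v h))

Closed : (ℕ → Bool) → Set
Closed P = ∀ a b → P a ≡ true → P b ≡ true → P (a + b) ≡ true

-- If y + 1 ∉ P then t ↦ y + 1 − t sends P ∩ [y] into the complement of P.
closed-reflect : ∀ P → Closed P → ∀ y → P (suc y) ≡ false →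
  count P y ≤ count (λ t → not (P t)) y
closed-reflect P closedP y y+1∉P = begin
  count P y                            ≤⟨ count-mono P (λ t → not (P (suc y ∸ t))) y partner-outside ⟩
  count (λ t → not (P (suc y ∸ t))) y  ≡⟨ sym (count-reflect (λ t → not (P t)) y) ⟩
  count (λ t → not (P t)) y            ∎
  where
  open ≤-Reasoning
  partner-outside : ∀ t → 1 ≤ t → t ≤ y → P t ≡ true → not (P (suc y ∸ t)) ≡ true
  partner-outside t _ t≤y t∈P with P (suc y ∸ t) in partner∈P
  ... | false = refl
  ... | true = contradiction (trans (sym y+1∈P) y+1∉P) (λ ())
    where
    y+1∈P : P (suc y) ≡ true
    y+1∈P = subst (λ s → P s ≡ true) (m+[n∸m]≡n (m≤n⇒m≤1+n t≤y)) (closedP t _ t∈P partner∈P)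

closed-half : ∀ P → Closed P → ∀ y → P (suc y) ≡ false → count P y + count P y ≤ y
closed-half P closedP y y+1∉P = subst (count P y + count P y ≤_) (count-compl P y)
  (+-monoʳ-≤ (count P y) (closed-reflect P closedP y y+1∉P))

closed-complement-half : ∀ P → Closed P → ∀ y → P (suc y) ≡ false →
  y ≤ count (λ t → not (P t)) y + count (λ t → not (P t)) y
closed-complement-half P closedP y y+1∉P = subst (_≤ count notP y + count notP y) (count-compl P y)
  (+-monoˡ-≤ (count notP y) (closed-reflect P closedP y y+1∉P))
  where
  notP : ℕ → Bool
  notP t = not (P t)

-- If P fills half of [m] and m + 1 ∈ P, then P contains every number above m:
-- a first missing m + d + 1 would make P fill more than half of [m + d].
closed-tail : ∀ P → Closed P → ∀ m → m ≤ count P m + count P m → P (suc m) ≡ true →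
  ∀ d → P (suc d + m) ≡ true
closed-tail P closedP m half m+1∈P d = proj₁ (filled d)
  where
  c = count P m
  filled : ∀ d → (P (suc d + m) ≡ true) × (count P (suc d + m) ≡ suc d + c)
  filled zero rewrite m+1∈P = refl , refl
  filled (suc d) with filled d
  ... | d∈P , count-d with P (suc (suc d + m)) in next
  ... | true = refl , cong suc count-d
  ... | false = contradiction (closed-half P closedP (suc d + m) next) (<⇒≱ more-than-half)
    where
    open ≤-Reasoning
    more-than-half : suc d + m < count P (suc d + m) + count P (suc d + m)
    more-than-half rewrite count-d = begin-strict
      suc d + m               ≤⟨ +-monoʳ-≤ (suc d) half ⟩
      suc d + (c + c)         <⟨ m<m+n (suc d + (c + c)) z<s ⟩
      suc d + (c + c) + suc d ≡⟨ regroup (suc d) c ⟩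
      suc d + c + (suc d + c) ∎
      where
      regroup : ∀ a b → a + (b + b) + a ≡ a + b + (a + b)
      regroup = solve-∀

Gap : NumericalSemigroup → ℕ → Bool
Gap S t = not (mem S t)

-- Since 0 ∈ S, the gaps below n + 1 are the gaps in [n].
gapsBelow≡count : ∀ S n → gapsBelow S (suc n) ≡ count (Gap S) n
gapsBelow≡count S zero rewrite zero∈ S = refl
gapsBelow≡count S (suc n) = cong₂ _+_ (gap-indicator (mem S (suc n))) (gapsBelow≡count S n)
  where
  gap-indicator : ∀ b → (if b then 0 else 1) ≡ ind (not b)
  gap-indicator true  = refl
  gap-indicator false = refl

gapsBelow-settles : ∀ S a → (∀ k → a ≤ k → k ∈S S) → ∀ b → gapsBelow S (b + a) ≡ gapsBelow S a
gapsBelow-settles S a full zero    = refl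
gapsBelow-settles S a full (suc b) rewrite full (b + a) (m≤n+m a b) = gapsBelow-settles S a full b

gapsBelow-mono : ∀ S a b → gapsBelow S a ≤ gapsBelow S (b + a)
gapsBelow-mono S a zero    = ≤-refl
gapsBelow-mono S a (suc b) = ≤-trans (gapsBelow-mono S a b) (m≤n+m _ _)

gapsBelow-past-witness : ∀ S g → (genus : HasGenus S g) → ∀ n → gapsBelow S (proj₁ genus + n) ≡ g
gapsBelow-past-witness S g (c , full , gaps≡g) n = begin
  gapsBelow S (c + n) ≡⟨ cong (gapsBelow S) (+-comm c n) ⟩
  gapsBelow S (n + c) ≡⟨ gapsBelow-settles S c full n ⟩
  gapsBelow S c       ≡⟨ gaps≡g ⟩
  g                   ∎
  where open ≡-Reasoning

gaps-≤-genus : ∀ S g → HasGenus S g → ∀ n → count (Gap S) n ≤ g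
gaps-≤-genus S g genus n = begin
  count (Gap S) n                      ≡⟨ sym (gapsBelow≡count S n) ⟩
  gapsBelow S (suc n)                  ≤⟨ gapsBelow-mono S (suc n) (proj₁ genus) ⟩
  gapsBelow S (proj₁ genus + suc n)    ≡⟨ gapsBelow-past-witness S g genus (suc n) ⟩
  g                                    ∎
  where open ≤-Reasoning

-- Every gap x satisfies x < 2g: by reflection [x − 1] holds at least (x − 1)/2
-- gaps, and x itself is one more.
gap-<-2g : ∀ S g → HasGenus S g → ∀ x → mem S x ≡ false → x < 2 * g
gap-<-2g S g genus zero    0∉S rewrite zero∈ S = contradiction 0∉S (λ ())
gap-<-2g S g genus (suc y) y+1∉S = begin
  suc (suc y)         ≤⟨ s≤s (s≤s (closed-complement-half (mem S) (closed S) y y+1∉S)) ⟩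
  suc (suc (G + G))   ≡⟨ cong suc (sym (+-suc G G)) ⟩
  suc G + suc G       ≤⟨ +-mono-≤ gaps-to-y+1 gaps-to-y+1 ⟩
  g + g               ≡⟨ cong (g +_) (sym (+-identityʳ g)) ⟩
  2 * g               ∎
  where
  open ≤-Reasoning
  G = count (Gap S) y
  gaps-to-y+1 : suc G ≤ g
  gaps-to-y+1 = subst (λ b → ind (not b) + G ≤ g) y+1∉S (gaps-≤-genus S g genus (suc y))

gaps-in-[2g] : ∀ S g → HasGenus S g → count (Gap S) (2 * g) ≡ g
gaps-in-[2g] S g genus = begin
  count (Gap S) (2 * g)                        ≡⟨ sym (gapsBelow≡count S (2 * g)) ⟩
  gapsBelow S (suc (2 * g))                    ≡⟨ sym (gapsBelow-settles S (suc (2 * g)) above-2g (proj₁ genus)) ⟩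
  gapsBelow S (proj₁ genus + suc (2 * g))      ≡⟨ gapsBelow-past-witness S g genus (suc (2 * g)) ⟩
  g                                            ∎
  where
  open ≡-Reasoning
  above-2g : ∀ k → suc (2 * g) ≤ k → k ∈S S
  above-2g k 2g<k with mem S k in k∈S
  ... | true  = refl
  ... | false = contradiction (≤-trans 2g<k (<⇒≤ (gap-<-2g S g genus k k∈S))) (<-irrefl refl)

Res : ℕ → ℕ → Bool
Res j t = t % 3 ≡ᵇ j

Res-sound : ∀ j t → Res j t ≡ true → t % 3 ≡ j
Res-sound j t res = ≡ᵇ⇒≡ (t % 3) j (Equivalence.from T-≡ res)

Res-complete : ∀ j t → t % 3 ≡ j → Res j t ≡ true
Res-complete j t t%3≡j = Equivalence.to T-≡ (≡⇒≡ᵇ (t % 3) j t%3≡j)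

one-in-three : ∀ j → j < 3 → ∀ n → ind (Res j (3 + n)) + (ind (Res j (2 + n)) + ind (Res j (1 + n))) ≡ 1
one-in-three j j<3 n =
  by-residue j j<3 (n % 3) (m%n<n n 3) (%-distribˡ-+ 3 n 3) (%-distribˡ-+ 2 n 3) (%-distribˡ-+ 1 n 3)
  where
  by-residue : ∀ j → j < 3 → ∀ r → r < 3 →
    (3 + n) % 3 ≡ (0 + r) % 3 → (2 + n) % 3 ≡ (2 + r) % 3 → (1 + n) % 3 ≡ (1 + r) % 3 →
    ind (Res j (3 + n)) + (ind (Res j (2 + n)) + ind (Res j (1 + n))) ≡ 1
  by-residue j j<3 r r<3 e₃ e₂ e₁ rewrite e₃ | e₂ | e₁ = cases j j<3 r r<3
    where
    cases : ∀ j → j < 3 → ∀ r → r < 3 →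
      ind ((0 + r) % 3 ≡ᵇ j) + (ind ((2 + r) % 3 ≡ᵇ j) + ind ((1 + r) % 3 ≡ᵇ j)) ≡ 1
    cases 0 _ 0 _ = refl
    cases 0 _ 1 _ = refl
    cases 0 _ 2 _ = refl
    cases 1 _ 0 _ = refl
    cases 1 _ 1 _ = refl
    cases 1 _ 2 _ = refl
    cases 2 _ 0 _ = refl
    cases 2 _ 1 _ = refl
    cases 2 _ 2 _ = refl
    cases (suc (suc (suc _))) (s≤s (s≤s (s≤s ()))) _ _
    cases _ _ (suc (suc (suc _))) (s≤s (s≤s (s≤s ())))

residue-count : ∀ j → 0 < j → j < 3 → ∀ n → count (Res j) n * 3 + j ≤ n + 3
residue-count 1 _ _ 0 = s≤s z≤n
residue-count 1 _ _ 1 = ≤-refl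
residue-count 1 _ _ 2 = n≤1+n 4
residue-count 2 _ _ 0 = n≤1+n 2
residue-count 2 _ _ 1 = s≤s (s≤s z≤n)
residue-count 2 _ _ 2 = ≤-refl
residue-count (suc (suc (suc _))) _ (s≤s (s≤s (s≤s ()))) _
residue-count j 0<j j<3 (suc (suc (suc n))) = begin
  count (Res j) (3 + n) * 3 + j  ≡⟨ cong (λ c → c * 3 + j) next-block ⟩
  3 + (count (Res j) n * 3 + j)  ≤⟨ +-monoʳ-≤ 3 (residue-count j 0<j j<3 n) ⟩
  3 + (n + 3)                    ∎
  where
  open ≤-Reasoning
  next-block : count (Res j) (3 + n) ≡ 1 + count (Res j) n
  next-block = begin-equality
    a + (b + (c + count (Res j) n))  ≡⟨ regroup a b c _ ⟩
    (a + (b + c)) + count (Res j) n  ≡⟨ cong (_+ count (Res j) n) (one-in-three j j<3 n) ⟩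
    1 + count (Res j) n              ∎
    where
    a = ind (Res j (3 + n))
    b = ind (Res j (2 + n))
    c = ind (Res j (1 + n))
    regroup : ∀ a b c d → a + (b + (c + d)) ≡ (a + (b + c)) + d
    regroup = solve-∀

sieve3 : ∀ (p : ℕ → Bool) n → count (λ t → p t ∧ Res 0 t) (n * 3) ≡ count (λ j → p (j * 3)) n
sieve3 p zero    = refl
sieve3 p (suc n)
  rewrite [m+kn]%n≡m%n 0 (suc n) 3 ⦃ _ ⦄ | [m+kn]%n≡m%n 2 n 3 ⦃ _ ⦄ | [m+kn]%n≡m%n 1 n 3 ⦃ _ ⦄
        | ∧-identityʳ (p (suc n * 3)) | ∧-zeroʳ (p (2 + n * 3)) | ∧-zeroʳ (p (1 + n * 3))
  = cong (ind (p (suc n * 3)) +_) (sieve3 p n)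

thirds : NumericalSemigroup → ℕ → Bool
thirds S j = mem S (j * 3)

thirds-closed : ∀ S → Closed (thirds S)
thirds-closed S a b a∈ b∈ = subst (λ s → mem S s ≡ true) (sym (*-distribʳ-+ 3 a b)) (closed S _ _ a∈ b∈)

module Hyperelliptic3 (S : NumericalSemigroup) (γ : ℕ) (hyp : Hyperelliptic 3 γ S) where

  -- The γ elements of S ∩ [6γ] are multiples of 3, so T/3 ∩ [2γ] has γ elements.
  thirds-count : count (thirds S) (2 * γ) ≡ γ
  thirds-count = begin
    count (thirds S) (2 * γ)                       ≡⟨ sym (sieve3 (mem S) (2 * γ)) ⟩
    count (λ t → mem S t ∧ Res 0 t) (2 * γ * 3)    ≡⟨ count-cong _ _ (2 * γ * 3) members-are-multiples ⟩
    count (mem S) (2 * γ * 3)                      ≡⟨ proj₁ hyp ⟩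
    γ                                              ∎
    where
    open ≡-Reasoning
    members-are-multiples : ∀ t → 1 ≤ t → t ≤ 2 * γ * 3 → (mem S t ∧ Res 0 t) ≡ mem S t
    members-are-multiples t 1≤t t≤6γ with mem S t in t∈S
    ... | false = refl
    ... | true  = Res-complete 0 t (n∣m⇒m%n≡0 t 3 (proj₁ (proj₂ (proj₂ hyp)) t 1≤t t≤6γ t∈S))

  -- T/3 fills half of [2γ] and contains 2γ + 1, so it contains everything above 2γ.
  multiples-above-6γ : ∀ t → t % 3 ≡ 0 → 2 * γ * 3 < t → t ∈S S
  multiples-above-6γ t t%3≡0 6γ<t with m%n≡0⇒n∣m t 3 t%3≡0
  ... | divides q refl = subst (λ j → thirds S j ≡ true) (m∸n+n≡m 2γ<q)
      (subst (λ j → thirds S j ≡ true) (sym (+-suc (q ∸ suc (2 * γ)) (2 * γ)))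
        (closed-tail (thirds S) (thirds-closed S) (2 * γ) half 2γ+1∈ (q ∸ suc (2 * γ))))
    where
    2γ<q : 2 * γ < q
    2γ<q = *-cancelʳ-< 3 (2 * γ) q 6γ<t
    half : 2 * γ ≤ count (thirds S) (2 * γ) + count (thirds S) (2 * γ)
    half = ≤-reflexive (trans (cong (γ +_) (+-identityʳ γ)) (sym (cong₂ _+_ thirds-count thirds-count)))
    2γ+1∈ : thirds S (suc (2 * γ)) ≡ true
    2γ+1∈ = subst (λ j → thirds S j ≡ true) (+-comm (2 * γ) 1) (proj₂ (proj₂ (proj₂ hyp)))

  -- Hence the gaps divisible by 3 are the 2γ − γ = γ non-members of T/3 ∩ [2γ].
  gap-multiples-≤-γ : ∀ n → count (λ t → Gap S t ∧ Res 0 t) n ≤ γ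
  gap-multiples-≤-γ n = begin
    count (λ t → Gap S t ∧ Res 0 t) n            ≤⟨ count-beyond _ (2 * γ * 3) none-above-6γ n ⟩
    count (λ t → Gap S t ∧ Res 0 t) (2 * γ * 3)  ≡⟨ sieve3 (Gap S) (2 * γ) ⟩
    count (λ j → not (thirds S j)) (2 * γ)       ≡⟨ +-cancelˡ-≡ γ _ _ complement ⟩
    γ                                            ∎
    where
    open ≤-Reasoning
    none-above-6γ : ∀ t → 2 * γ * 3 < t → (Gap S t ∧ Res 0 t) ≡ false
    none-above-6γ t 6γ<t with Res 0 t in t%3≡0
    ... | false = ∧-zeroʳ (Gap S t)
    ... | true rewrite multiples-above-6γ t (Res-sound 0 t t%3≡0) 6γ<t = refl
    complement : γ + count (λ j → not (thirds S j)) (2 * γ) ≡ γ + γ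
    complement = begin-equality
      γ + count (λ j → not (thirds S j)) (2 * γ)
        ≡⟨ cong (_+ count (λ j → not (thirds S j)) (2 * γ)) (sym thirds-count) ⟩
      count (thirds S) (2 * γ) + count (λ j → not (thirds S j)) (2 * γ)
        ≡⟨ count-compl (thirds S) (2 * γ) ⟩
      γ + (γ + 0)
        ≡⟨ cong (γ +_) (+-identityʳ γ) ⟩
      γ + γ
        ∎

residue-cancel : ∀ t u → (t + u) % 3 ≡ u % 3 → t % 3 ≡ 0
residue-cancel t u same = by-residue (t % 3) (u % 3) (m%n<n t 3) (m%n<n u 3)
  (trans (sym (%-distribˡ-+ t u 3)) same)
  where
  by-residue : ∀ a b → a < 3 → b < 3 → (a + b) % 3 ≡ b → a ≡ 0
  by-residue 0 _ _ _ _ = refl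
  by-residue 1 0 _ _ ()
  by-residue 1 1 _ _ ()
  by-residue 1 2 _ _ ()
  by-residue 2 0 _ _ ()
  by-residue 2 1 _ _ ()
  by-residue 2 2 _ _ ()
  by-residue (suc (suc (suc _))) _ (s≤s (s≤s (s≤s ()))) _ _
  by-residue _ (suc (suc (suc _))) _ (s≤s (s≤s (s≤s ()))) _

-- For an element u > 0 of S with residue r: a gap t + u of residue r forces the
-- gap t of residue 0, and u itself is a non-gap of residue r.
gaps-of-element-residue : ∀ S u → u ∈S S → 0 < u → ∀ n →
  count (λ t → Gap S t ∧ Res (u % 3) t) n + 1 ≤ count (Res (u % 3)) u + count (λ t → Gap S t ∧ Res 0 t) n
gaps-of-element-residue S u@(suc v) u∈S _ n = begin
  count Gr n + 1                                  ≤⟨ +-monoˡ-≤ 1 (count-monoN Gr (m≤m+n n u)) ⟩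
  count Gr (n + u) + 1                            ≡⟨ cong (_+ 1) (count-split Gr n u) ⟩
  count (λ t → Gr (t + u)) n + count Gr u + 1     ≡⟨ +-assoc (count (λ t → Gr (t + u)) n) _ 1 ⟩
  count (λ t → Gr (t + u)) n + (count Gr u + 1)   ≤⟨ +-mono-≤ (count-mono _ G₀ n shift-down) up-to-u ⟩
  count G₀ n + count (Res r) u                    ≡⟨ +-comm (count G₀ n) _ ⟩
  count (Res r) u + count G₀ n                    ∎
  where
  open ≤-Reasoning
  r = u % 3
  Gr G₀ : ℕ → Bool
  Gr t = Gap S t ∧ Res r t
  G₀ t = Gap S t ∧ Res 0 t
  shift-down : ∀ t → 1 ≤ t → t ≤ n → Gr (t + u) ≡ true → G₀ t ≡ true
  shift-down t _ _ gap with mem S t in t∈S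
  ... | true  = contradiction (trans (sym gap) (cong (λ b → not b ∧ Res r (t + u)) (closed S t u t∈S u∈S))) (λ ())
  ... | false =
    Res-complete 0 t (residue-cancel t u (Res-sound r (t + u) (∧-conicalʳ (Gap S (t + u)) _ gap)))
  up-to-u : count Gr u + 1 ≤ count (Res r) u
  up-to-u = count-strict Gr (Res r) v (cong (λ b → not b ∧ Res r u) u∈S) (Res-complete r u refl)
    (λ t _ _ → ∧-conicalʳ (Gap S t) (Res r t))

-- For r ∈ {1,2} the residues 0, r and 3 − r are all distinct, so each gap is
-- counted by one of them, and an element of residue 3 − r is not a gap.
residue-cover : ∀ (b : Bool) a r → a < 3 → 0 < r → r < 3 →
  ind (b ∧ (a ≡ᵇ 3 ∸ r)) + ind (not b) ≤ ind (a ≡ᵇ 3 ∸ r) + (ind (not b ∧ (a ≡ᵇ 0)) + ind (not b ∧ (a ≡ᵇ r)))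
residue-cover true  _ _ _ _ _ = ≤-refl
residue-cover false 0 1 _ _ _ = ≤-refl
residue-cover false 0 2 _ _ _ = ≤-refl
residue-cover false 1 1 _ _ _ = ≤-refl
residue-cover false 1 2 _ _ _ = ≤-refl
residue-cover false 2 1 _ _ _ = ≤-refl
residue-cover false 2 2 _ _ _ = ≤-refl
residue-cover false (suc (suc (suc _))) _ (s≤s (s≤s (s≤s ()))) _ _
residue-cover false _ 0 _ () _
residue-cover false _ (suc (suc (suc _))) _ _ (s≤s (s≤s (s≤s ())))

residue-classes : ∀ S r → 0 < r → r < 3 → ∀ n →
  count (λ t → mem S t ∧ Res (3 ∸ r) t) n + count (Gap S) n ≤
  count (Res (3 ∸ r)) n + (count (λ t → Gap S t ∧ Res 0 t) n + count (λ t → Gap S t ∧ Res r t) n)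
residue-classes S r 0<r r<3 n = begin
  count elem n + count (Gap S) n
    ≡⟨ cong₂ _+_ (count≡sumTo elem n) (count≡sumTo (Gap S) n) ⟩
  sumTo (indOf elem) n + sumTo (indOf (Gap S)) n
    ≡⟨ sym (sumTo-+ (indOf elem) (indOf (Gap S)) n) ⟩
  sumTo (λ t → indOf elem t + indOf (Gap S) t) n
    ≤⟨ sumTo-mono _ _ n (λ t _ _ → residue-cover (mem S t) (t % 3) r (m%n<n t 3) 0<r r<3) ⟩
  sumTo (λ t → indOf (Res i) t + (indOf G₀ t + indOf Gr t)) n
    ≡⟨ sumTo-+ (indOf (Res i)) _ n ⟩
  sumTo (indOf (Res i)) n + sumTo (λ t → indOf G₀ t + indOf Gr t) n
    ≡⟨ cong (sumTo (indOf (Res i)) n +_) (sumTo-+ (indOf G₀) (indOf Gr) n) ⟩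
  sumTo (indOf (Res i)) n + (sumTo (indOf G₀) n + sumTo (indOf Gr) n)
    ≡⟨ sym (cong₂ _+_ (count≡sumTo (Res i) n) (cong₂ _+_ (count≡sumTo G₀ n) (count≡sumTo Gr n))) ⟩
  count (Res i) n + (count G₀ n + count Gr n)
    ∎
  where
  open ≤-Reasoning
  i = 3 ∸ r
  indOf : (ℕ → Bool) → ℕ → ℕ
  indOf p t = ind (p t)
  elem G₀ Gr : ℕ → Bool
  elem t = mem S t ∧ Res i t
  G₀ t = Gap S t ∧ Res 0 t
  Gr t = Gap S t ∧ Res r t

combine-bounds : ∀ {X g γ u i r Aᵢ Aᵣ G₀ Gᵣ} →
  X + g ≤ Aᵢ + (G₀ + Gᵣ) → G₀ ≤ γ → Gᵣ + 1 ≤ Aᵣ + G₀ →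
  Aᵢ * 3 + i ≤ 2 * g + 3 → Aᵣ * 3 + r ≤ u + 3 → i + r ≡ 3 →
  X * 3 + g ≤ u + 3 * γ + 3 * γ
combine-bounds {X} {g} {γ} {u} {i} {r} {Aᵢ} {Aᵣ} {G₀} {Gᵣ} classes G₀≤γ Gᵣ≤ Aᵢ≤ Aᵣ≤ i+r≡3 =
  +-cancelʳ-≤ (2 * g + 6) _ _ (begin
    X * 3 + g + (2 * g + 6)                    ≡⟨ e₁ X g ⟩
    (X + g) * 3 + 3 + 3                        ≡⟨ cong ((X + g) * 3 + 3 +_) (sym i+r≡3) ⟩
    (X + g) * 3 + 3 + (i + r)                  ≤⟨ +-monoˡ-≤ (i + r) (+-monoˡ-≤ 3 (*-monoˡ-≤ 3 classes)) ⟩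
    (Aᵢ + (G₀ + Gᵣ)) * 3 + 3 + (i + r)         ≡⟨ e₂ Aᵢ G₀ Gᵣ i r ⟩
    (Aᵢ * 3 + i) + G₀ * 3 + ((Gᵣ + 1) * 3 + r) ≤⟨ +-mono-≤ (+-mono-≤ Aᵢ≤ (*-monoˡ-≤ 3 G₀≤γ)) (+-monoˡ-≤ r (*-monoˡ-≤ 3 Gᵣ≤)) ⟩
    (2 * g + 3) + γ * 3 + ((Aᵣ + G₀) * 3 + r)  ≡⟨ e₃ g γ Aᵣ G₀ r ⟩
    (2 * g + 3) + γ * 3 + (Aᵣ * 3 + r) + G₀ * 3 ≤⟨ +-mono-≤ (+-monoʳ-≤ (2 * g + 3 + γ * 3) Aᵣ≤) (*-monoˡ-≤ 3 G₀≤γ) ⟩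
    (2 * g + 3) + γ * 3 + (u + 3) + γ * 3      ≡⟨ e₄ g γ u ⟩
    u + 3 * γ + 3 * γ + (2 * g + 6)            ∎)
  where
  open ≤-Reasoning
  e₁ : ∀ X g → X * 3 + g + (2 * g + 6) ≡ (X + g) * 3 + 3 + 3
  e₁ = solve-∀
  e₂ : ∀ A G H i r → (A + (G + H)) * 3 + 3 + (i + r) ≡ (A * 3 + i) + G * 3 + ((H + 1) * 3 + r)
  e₂ = solve-∀
  e₃ : ∀ g γ A G r → (2 * g + 3) + γ * 3 + ((A + G) * 3 + r) ≡ (2 * g + 3) + γ * 3 + (A * 3 + r) + G * 3
  e₃ = solve-∀
  e₄ : ∀ g γ u → (2 * g + 3) + γ * 3 + (u + 3) + γ * 3 ≡ u + 3 * γ + 3 * γ + (2 * g + 6)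
  e₄ = solve-∀

-- k ≤ ⌈x/3⌉ as soon as 3k < x + 3: otherwise ⌊−x/3⌋ < −k + 1 would fail.
ceil3-≥ : ∀ k x → k ℤ.* ℤ.+ 3 ℤ.< x ℤ.+ ℤ.+ 3 → k ℤ.≤ ceil3 x
ceil3-≥ k x 3k<x+3 = subst (ℤ._≤ ceil3 x) (ℤP.neg-involutive k) (ℤP.neg-mono-≤ q≤-k)
  where
  q = (ℤ.- x) ℤ./ℕ 3
  -x<3[1-k] : ℤ.- x ℤ.< (ℤ.+ 1 ℤ.+ ℤ.- k) ℤ.* ℤ.+ 3
  -x<3[1-k] = subst₂ ℤ._<_ (e₁ k x) (e₂ k x) (ℤP.+-monoˡ-< (ℤ.- x ℤ.- k ℤ.* ℤ.+ 3) 3k<x+3)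
    where
    e₁ : ∀ k x → k ℤ.* ℤ.+ 3 ℤ.+ (ℤ.- x ℤ.- k ℤ.* ℤ.+ 3) ≡ ℤ.- x
    e₁ = ℤSolver.solve-∀
    e₂ : ∀ k x → x ℤ.+ ℤ.+ 3 ℤ.+ (ℤ.- x ℤ.- k ℤ.* ℤ.+ 3) ≡ (ℤ.+ 1 ℤ.+ ℤ.- k) ℤ.* ℤ.+ 3
    e₂ = ℤSolver.solve-∀
  q<1-k : q ℤ.< ℤ.suc (ℤ.- k)
  q<1-k = ℤP.*-cancelʳ-<-nonNeg (ℤ.+ 3) (ℤP.≤-<-trans ([n/ℕd]*d≤n (ℤ.- x) 3) -x<3[1-k])
  q≤-k : q ℤ.≤ ℤ.- k
  q≤-k = subst (q ℤ.≤_) (ℤP.pred-suc (ℤ.- k)) (ℤP.i<j⇒i≤pred[j] q<1-k)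

ceil-bound : ∀ X g γ u f → f ≤ 1 → X * 3 + g ≤ u + 3 * γ + 3 * γ →
  ℤ.+ X ℤ.≤ ℤ.+ γ ℤ.+ ceil3 (ℤ.+ u ℤ.- ℤ.+ g ℤ.+ ℤ.+ (3 * γ) ℤ.- ℤ.+ 1 ℤ.- ℤ.+ f)
ceil-bound X g γ u f f≤1 3X+g≤u+6γ = begin
  ℤ.+ X                      ≡⟨ e₀ (ℤ.+ X) (ℤ.+ γ) ⟩
  ℤ.+ γ ℤ.+ k                ≤⟨ ℤP.+-monoʳ-≤ (ℤ.+ γ) (ceil3-≥ k χ 3k<χ+3) ⟩
  ℤ.+ γ ℤ.+ ceil3 χ          ∎
  where
  open ℤP.≤-Reasoning
  k = ℤ.+ X ℤ.- ℤ.+ γ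
  χ = ℤ.+ u ℤ.- ℤ.+ g ℤ.+ ℤ.+ (3 * γ) ℤ.- ℤ.+ 1 ℤ.- ℤ.+ f
  e₀ : ∀ x y → x ≡ y ℤ.+ (x ℤ.- y)
  e₀ = ℤSolver.solve-∀
  lhs : ℤ.+ (X * 3 + g) ≡ ℤ.+ X ℤ.* ℤ.+ 3 ℤ.+ ℤ.+ g
  lhs = trans (ℤP.pos-+ (X * 3) g) (cong (ℤ._+ ℤ.+ g) (ℤP.pos-* X 3))
  rhs : ℤ.+ (u + 3 * γ + 3 * γ) ≡ ℤ.+ u ℤ.+ ℤ.+ (3 * γ) ℤ.+ ℤ.+ (3 * γ)
  rhs = trans (ℤP.pos-+ (u + 3 * γ) (3 * γ)) (cong (ℤ._+ ℤ.+ (3 * γ)) (ℤP.pos-+ u (3 * γ)))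
  3X+g≤u+6γ′ : ℤ.+ X ℤ.* ℤ.+ 3 ℤ.+ ℤ.+ g ℤ.≤ ℤ.+ u ℤ.+ ℤ.+ (3 * γ) ℤ.+ ℤ.+ (3 * γ)
  3X+g≤u+6γ′ = subst₂ ℤ._≤_ lhs rhs (ℤ.+≤+ 3X+g≤u+6γ)
  f+1<3 : ℤ.+ f ℤ.+ ℤ.+ 1 ℤ.< ℤ.+ 3
  f+1<3 = ℤ.+<+ (+-monoˡ-< 1 (s≤s f≤1))
  3k<χ+3 : k ℤ.* ℤ.+ 3 ℤ.< χ ℤ.+ ℤ.+ 3
  3k<χ+3 = begin-strict
    k ℤ.* ℤ.+ 3
      ≡⟨ e₁ (ℤ.+ X) (ℤ.+ g) (ℤ.+ γ) ⟩
    (ℤ.+ X ℤ.* ℤ.+ 3 ℤ.+ ℤ.+ g) ℤ.+ (ℤ.- ℤ.+ g ℤ.- ℤ.+ 3 ℤ.* ℤ.+ γ)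
      ≡⟨ cong (λ a → ℤ.+ X ℤ.* ℤ.+ 3 ℤ.+ ℤ.+ g ℤ.+ (ℤ.- ℤ.+ g ℤ.- a)) (sym (ℤP.pos-* 3 γ)) ⟩
    (ℤ.+ X ℤ.* ℤ.+ 3 ℤ.+ ℤ.+ g) ℤ.+ (ℤ.- ℤ.+ g ℤ.- ℤ.+ (3 * γ))
      ≤⟨ ℤP.+-monoˡ-≤ (ℤ.- ℤ.+ g ℤ.- ℤ.+ (3 * γ)) 3X+g≤u+6γ′ ⟩
    (ℤ.+ u ℤ.+ ℤ.+ (3 * γ) ℤ.+ ℤ.+ (3 * γ)) ℤ.+ (ℤ.- ℤ.+ g ℤ.- ℤ.+ (3 * γ))
      ≡⟨ e₂ (ℤ.+ u) (ℤ.+ g) (ℤ.+ (3 * γ)) (ℤ.+ f) ⟩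
    χ ℤ.+ (ℤ.+ f ℤ.+ ℤ.+ 1)
      <⟨ ℤP.+-monoʳ-< χ f+1<3 ⟩
    χ ℤ.+ ℤ.+ 3
      ∎
    where
    e₁ : ∀ x g c → (x ℤ.- c) ℤ.* ℤ.+ 3 ≡ (x ℤ.* ℤ.+ 3 ℤ.+ g) ℤ.+ (ℤ.- g ℤ.- ℤ.+ 3 ℤ.* c)
    e₁ = ℤSolver.solve-∀
    e₂ : ∀ u g a f → (u ℤ.+ a ℤ.+ a) ℤ.+ (ℤ.- g ℤ.- a) ≡ (u ℤ.- g ℤ.+ a ℤ.- ℤ.+ 1 ℤ.- f) ℤ.+ (f ℤ.+ ℤ.+ 1)
    e₂ = ℤSolver.solve-∀

half-residue-≤-1 : ∀ g → (g % 3) / 2 ≤ 1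
half-residue-≤-1 g = by-residue (g % 3) (m%n<n g 3)
  where
  by-residue : ∀ a → a < 3 → a / 2 ≤ 1
  by-residue 0 _ = z≤n
  by-residue 1 _ = z≤n
  by-residue 2 _ = ≤-refl
  by-residue (suc (suc (suc _))) (s≤s (s≤s (s≤s ())))

lemma2p2 : (g γ : ℕ) (T : NumericalSemigroup) → Hyperelliptic 3 γ T → HasGenus T g →
    (u₁ : ℕ) → IsU1 T u₁ →
    ℤ.+ cardT T g (3 ∸ (u₁ % 3)) ℤ.≤ ℤ.+ γ ℤ.+ ceil3 (chi u₁ g γ)
-- Only u₁ ∈ T and (u₁)₃ ≠ 0 are used, not the minimality of u₁.
lemma2p2 g γ T hyp genus u₁ (u₁∈T , r≢0 , _) =
  ceil-bound (cardT T g i) g γ u₁ ((g % 3) / 2) (half-residue-≤-1 g) 3X+g≤u₁+6γ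
  where
  open Hyperelliptic3 T γ hyp
  r = u₁ % 3
  i = 3 ∸ r
  r<3 : r < 3
  r<3 = m%n<n u₁ 3
  0<r : 0 < r
  0<r = n≢0⇒n>0 r≢0
  0<i : 0 < i
  0<i = m<n⇒0<n∸m r<3
  i<3 : i < 3
  i<3 = ∸-monoʳ-< 0<r (<⇒≤ r<3)
  0<u₁ : 0 < u₁
  0<u₁ = n≢0⇒n>0 (λ u₁≡0 → r≢0 (cong (_% 3) u₁≡0))
  Aᵢ G₀ Gᵣ : ℕ
  Aᵢ = count (Res i) (2 * g)
  G₀ = count (λ t → Gap T t ∧ Res 0 t) (2 * g)
  Gᵣ = count (λ t → Gap T t ∧ Res r t) (2 * g)
  classes : cardT T g i + g ≤ Aᵢ + (G₀ + Gᵣ)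
  classes = subst (λ G → cardT T g i + G ≤ Aᵢ + (G₀ + Gᵣ)) (gaps-in-[2g] T g genus)
    (residue-classes T r 0<r r<3 (2 * g))
  3X+g≤u₁+6γ : cardT T g i * 3 + g ≤ u₁ + 3 * γ + 3 * γ
  3X+g≤u₁+6γ = combine-bounds {X = cardT T g i} {g} {γ} {u₁} {i} {r} {Aᵢ} {count (Res r) u₁} {G₀} {Gᵣ}
    classes
    (gap-multiples-≤-γ (2 * g))
    (gaps-of-element-residue T u₁ u₁∈T 0<u₁ (2 * g))
    (residue-count i 0<i i<3 (2 * g))
    (residue-count r 0<r r<3 u₁)
    (m∸n+n≡m (<⇒≤ r<3))
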